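{- Let $u\equiv 0\pmod{12}$. Then the graph $\langle \mathbb Z_u\cup\{\infty_1,\infty_2,\infty_3,\infty_4\},\{2\}\rangle$ can be decomposed into $3$-suns.
   Context: A $3$-sun is the graph on six vertices $a,b,c,d,e,f$ with edges $\{a,b\},\{b,c\},\{c,a\},\{a,d\},\{b,e\},\{c,f\}$; a decomposition of a graph into $3$-suns is a partition of its edge set into subgraphs isomorphic to a $3$-sun. For a positive integer $u$, $\mathbb Z_u=\{0,1,\dots,u-1\}$ (integers mod $u$), and for distinct $i,j\in\mathbb Z_u$, $|i-j|_u=\min\{|i-j|,u-|i-j|\}$. For a set $H$ disjoint from $\mathbb Z_u$ and a nonempty set $D\subseteq\{1,\dots,\lfloor u/2\rfloor\}$, $\langle \mathbb Z_u\cup H,D\rangle$ is the graph with vertex set $\mathbb Z_u\cup H$ and edge set $\{\{i,j\}: i,j\in\mathbb Z_u,\ |i-j|_u\in D\}\cup\{\{\infty,i\}:\infty\in H,\ i\in\mathbb Z_u\}$. -}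

module Defs where

open import Data.Nat using (ℕ; _∸_; ∣_-_∣; _⊓_)
open import Data.Fin using (Fin; toℕ)
import Data.Fin as Fin
open import Data.Sum using (_⊎_; inj₁; inj₂)
open import Data.Sum.Properties using (≡-dec)
open import Data.Product using (_×_; _,_; ∃)
open import Data.List using (List; []; _∷_; concatMap)
open import Data.List.Membership.Propositional using (_∈_)
open import Data.List.Relation.Unary.All using (All)
open import Data.List.Relation.Unary.Unique.Propositional using (Unique)
open import Data.Unit using (⊤)
open import Data.Empty using (⊥)
open import Relation.Nullary using (¬_; yes; no)
open import Relation.Binary.Definitions using (DecidableEquality)
open import Relation.Binary.PropositionalEquality using (_≡_)

record Graph : Set₁ where
  field
    V    : Set
    _≟V_ : DecidableEquality V
    Adj  : V → V → Set        -- symmetric adjacency relation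

record Sun (V : Set) : Set where
  constructor sun
  field
    a b c d e f : V

sunVertices : {V : Set} → Sun V → List V
sunVertices (sun a b c d e f) = a ∷ b ∷ c ∷ d ∷ e ∷ f ∷ []

sunEdges : {V : Set} → Sun V → List (V × V)
sunEdges (sun a b c d e f) =
  (a , b) ∷ (b , c) ∷ (c , a) ∷ (a , d) ∷ (b , e) ∷ (c , f) ∷ []

countEdge : {V : Set} → DecidableEquality V → V → V → List (V × V) → ℕ
countEdge _≟_ x y [] = 0
countEdge _≟_ x y ((p , q) ∷ es) with p ≟ x | q ≟ y | p ≟ y | q ≟ x
... | yes _ | yes _ | _     | _     = Data.Nat.suc (countEdge _≟_ x y es)
... | _     | _     | yes _ | yes _ = Data.Nat.suc (countEdge _≟_ x y es)
... | _     | _     | _     | _     = countEdge _≟_ x y es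

IsSunDecomposition : (G : Graph) → List (Sun (Graph.V G)) → Set
IsSunDecomposition G S =
  (∀ s → s ∈ S → Unique (sunVertices s)
                 × All (λ { (x , y) → Adj x y }) (sunEdges s))
  × (∀ x y → Adj x y → countEdge _≟V_ x y (concatMap sunEdges S) ≡ 1)
  where open Graph G

SunDecomposable : Graph → Set
SunDecomposable G = ∃ λ (S : List (Sun (Graph.V G))) → IsSunDecomposition G S

-- The graph ⟨ℤ_u ∪ H, D⟩ with H = {∞_1,…,∞_h} (represented by Fin h),
-- D given as a list of positive integers.

circDist : (u : ℕ) → Fin u → Fin u → ℕ
circDist u i j = ∣ toℕ i - toℕ j ∣ ⊓ (u ∸ ∣ toℕ i - toℕ j ∣)

CircAdj : (u h : ℕ) → List ℕ → Fin u ⊎ Fin h → Fin u ⊎ Fin h → Set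
CircAdj u h D (inj₁ i) (inj₁ j) = ¬ (i ≡ j) × circDist u i j ∈ D
CircAdj u h D (inj₁ i) (inj₂ _) = ⊤
CircAdj u h D (inj₂ _) (inj₁ j) = ⊤
CircAdj u h D (inj₂ _) (inj₂ _) = ⊥

CircGraph : (u h : ℕ) → List ℕ → Graph
CircGraph u h D = record
  { V    = Fin u ⊎ Fin h
  ; _≟V_ = ≡-dec Fin._≟_ Fin._≟_
  ; Adj  = CircAdj u h D
  }

-- Write u = 12q and label every edge of the graph by a vertex i of ℤ_u together with a kind:
-- the spoke {i, ∞_h} or the chord {i, i + 2}. Since u > 4, every edge carries exactly one
-- label. The ten base suns below use only the vertices 0, …, 13 and the four points at
-- infinity, and their edges carry each of the 60 labels with i < 12 exactly once. Hence their
-- translates by 12j, for j < q, carry every label exactly once; and they are still suns, because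
-- the six vertices of a base sun are already distinct modulo 12.

module Submission where

open import Defs
open import Data.Empty using (⊥; ⊥-elim)
open import Data.Fin as Fin using (Fin; toℕ; combine; remQuot)
open import Data.Fin.Patterns using (0F; 1F; 2F; 3F)
open import Data.Fin.Properties using (toℕ-injective; toℕ<n; toℕ-fromℕ<; toℕ-combine; combine-injective; combine-remQuot)
open import Data.List using (List; []; _∷_; _++_; map; concatMap; filter; length; cartesianProduct; cartesianProductWith; allFin)
open import Data.List.Properties using (map-++; map-cong; map-∘; concatMap-++; concatMap-map; map-concatMap; filter-none)
open import Data.List.Membership.Propositional using (_∈_)
open import Data.List.Membership.Propositional.Properties using (∈-map⁺; ∈-allFin; ∈-cartesianProduct⁺; ∈-cartesianProduct⁻; ∈-cartesianProductWith⁺)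
import Data.List.Membership.DecPropositional as DecMembership
open import Data.List.Relation.Binary.Pointwise as Pointwise using (Pointwise; []; _∷_)
open import Data.List.Relation.Unary.All as All using (All; []; _∷_)
import Data.List.Relation.Unary.All.Properties as All
open import Data.List.Relation.Unary.Any using (here; there)
open import Data.List.Relation.Unary.Unique.Propositional using (Unique; _∷_)
import Data.List.Relation.Unary.Unique.Propositional.Properties as Unique
import Data.List.Relation.Unary.Unique.DecPropositional as DecUnique
open import Data.Nat using (ℕ; suc; _+_; _*_; _∸_; _⊓_; _<_; _≤_; ∣_-_∣; _%_; NonZero; z≤n; s≤s)
open import Data.Nat.DivMod using (_mod_; m%n<n; m<n⇒m%n≡m; m≤n⇒[n∸m]%m≡n%m; [m+n]%n≡m%n; %-distribˡ-+; m%n%n≡m%n; m∣n⇒o%n%m≡o%m; %-remove-+ˡ)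
open import Data.Nat.Divisibility using (_∣_; divides; m∣m*n)
open import Data.Nat.Properties
open import Data.Product using (_×_; _,_; proj₁; proj₂; swap; uncurry)
import Data.Product.Properties as Productₚ
open import Data.Sum as Sum using (_⊎_; inj₁; inj₂; [_,_])
import Data.Sum.Properties as Sumₚ
open import Data.Unit using (tt)
open import Function using (_∘_; id)
open import Relation.Binary.Definitions using (DecidableEquality)
open import Relation.Binary.PropositionalEquality using (_≡_; _≢_; refl; sym; trans; cong; cong₂; subst; module ≡-Reasoning)
open import Relation.Nullary using (¬_; Dec; yes; no; _×-dec_)
open import Relation.Nullary.Decidable using (from-yes)
import Relation.Nullary.Decidable as Dec
open import Relation.Unary using (Decidable)

private
  variable
    A B C D I : Set

Pointwise-concatMap : ∀ {R : A → B → Set} (f : I → List A) (g : I → List C) (h : C → B) {is} →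
                      All (λ i → Pointwise R (f i) (map h (g i))) is →
                      Pointwise R (concatMap f is) (map h (concatMap g is))
Pointwise-concatMap f g h []                = []
Pointwise-concatMap {R = R} f g h {i ∷ is} (r ∷ rs) =
  subst (Pointwise R _) (sym (map-++ h (g i) (concatMap g is)))
        (Pointwise.++⁺ r (Pointwise-concatMap f g h rs))

All⇒Pointwise-map : ∀ {R : B → C → Set} {f : A → B} {g : A → C} {xs} →
                    All (λ x → R (f x) (g x)) xs → Pointwise R (map f xs) (map g xs)
All⇒Pointwise-map []       = []
All⇒Pointwise-map (r ∷ rs) = r ∷ All⇒Pointwise-map rs

concatMap-cartesianProduct : (g : A → C → D) (h : B → List C) (xs : List A) (ys : List B) →
                             concatMap (uncurry λ x y → map (g x) (h y)) (cartesianProduct xs ys)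
                             ≡ cartesianProductWith g xs (concatMap h ys)
concatMap-cartesianProduct g h []       ys = refl
concatMap-cartesianProduct g h (x ∷ xs) ys = begin
  concatMap F (map (x ,_) ys ++ cartesianProduct xs ys)
    ≡⟨ concatMap-++ F (map (x ,_) ys) (cartesianProduct xs ys) ⟩
  concatMap F (map (x ,_) ys) ++ concatMap F (cartesianProduct xs ys)
    ≡⟨ cong₂ _++_ (trans (concatMap-map F (x ,_) ys) (sym (map-concatMap (g x) h ys)))
                  (concatMap-cartesianProduct g h xs ys) ⟩
  map (g x) (concatMap h ys) ++ cartesianProductWith g xs (concatMap h ys) ∎
  where
  open ≡-Reasoning
  F = uncurry λ x y → map (g x) (h y)

%-wrap : ∀ {m n} .{{_ : NonZero n}} → n ≤ m → m < n + n → m % n + n ≡ m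
%-wrap {m} {n} n≤m m<n+n = begin
  m % n + n       ≡⟨ cong (_+ n) (m≤n⇒[n∸m]%m≡n%m n≤m) ⟨
  (m ∸ n) % n + n ≡⟨ cong (_+ n) (m<n⇒m%n≡m (m<n+o⇒m∸n<o m n m<n+n)) ⟩
  m ∸ n + n       ≡⟨ m∸n+n≡m n≤m ⟩
  m               ∎
  where open ≡-Reasoning

[m+1+o]%n≢m : ∀ {m n} o .{{_ : NonZero n}} → m < n → suc o < n → (m + suc o) % n ≢ m
[m+1+o]%n≢m {m} {n} o m<n 1+o<n m+1+o%n≡m with m + suc o <? n
... | yes m+1+o<n = m+1+n≢m m (trans (sym (m<n⇒m%n≡m m+1+o<n)) m+1+o%n≡m)
... | no m+1+o≮n = <⇒≢ 1+o<n (sym (+-cancelˡ-≡ m n (suc o) (begin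
  m + n                 ≡⟨ cong (_+ n) m+1+o%n≡m ⟨
  (m + suc o) % n + n   ≡⟨ %-wrap (≮⇒≥ m+1+o≮n) (+-mono-<-≤ m<n (<⇒≤ 1+o<n)) ⟩
  m + suc o             ∎)))
  where open ≡-Reasoning

-- Counting edges through a labelling

Joins : {V : Set} → V × V → V → V → Set
Joins (p , q) x y = (p ≡ x × q ≡ y) ⊎ (p ≡ y × q ≡ x)

SameEdge : {V : Set} → V × V → V × V → Set
SameEdge e e′ = e ≡ e′ ⊎ e ≡ swap e′

module _ {V : Set} where

  Joins-swap : ∀ {p q x y : V} → Joins (p , q) x y → Joins (q , p) x y
  Joins-swap (inj₁ (p≡x , q≡y)) = inj₂ (q≡y , p≡x)
  Joins-swap (inj₂ (p≡y , q≡x)) = inj₁ (q≡x , p≡y)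

  SameEdge-sym : ∀ {e e′ : V × V} → SameEdge e e′ → SameEdge e′ e
  SameEdge-sym (inj₁ refl) = inj₁ refl
  SameEdge-sym (inj₂ refl) = inj₂ refl

  Joins-resp : ∀ {e e′ : V × V} {x y} → SameEdge e e′ → Joins e x y → Joins e′ x y
  Joins-resp (inj₁ refl) j = j
  Joins-resp (inj₂ refl) j = Joins-swap j

  module _ (_≟_ : DecidableEquality V) where

    countEdge-joins : ∀ {e : V × V} {x y} es → Joins e x y →
                      countEdge _≟_ x y (e ∷ es) ≡ suc (countEdge _≟_ x y es)
    countEdge-joins {p , q} {x} {y} _ j with p ≟ x | q ≟ y | p ≟ y | q ≟ x
    ... | yes _   | yes _   | _       | _       = refl
    ... | yes _   | no _    | yes _   | yes _   = refl
    ... | yes _   | no q≢y  | yes _   | no q≢x  = ⊥-elim ([ q≢y ∘ proj₂ , q≢x ∘ proj₂ ] j)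
    ... | yes _   | no q≢y  | no p≢y  | _       = ⊥-elim ([ q≢y ∘ proj₂ , p≢y ∘ proj₁ ] j)
    ... | no _    | _       | yes _   | yes _   = refl
    ... | no p≢x  | _       | yes _   | no q≢x  = ⊥-elim ([ p≢x ∘ proj₁ , q≢x ∘ proj₂ ] j)
    ... | no p≢x  | _       | no p≢y  | _       = ⊥-elim ([ p≢x ∘ proj₁ , p≢y ∘ proj₁ ] j)

    countEdge-¬joins : ∀ {e : V × V} {x y} es → ¬ Joins e x y →
                       countEdge _≟_ x y (e ∷ es) ≡ countEdge _≟_ x y es
    countEdge-¬joins {p , q} {x} {y} _ ¬j with p ≟ x | q ≟ y | p ≟ y | q ≟ x
    ... | yes p≡x | yes q≡y | _       | _       = ⊥-elim (¬j (inj₁ (p≡x , q≡y)))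
    ... | yes _   | no _    | yes p≡y | yes q≡x = ⊥-elim (¬j (inj₂ (p≡y , q≡x)))
    ... | yes _   | no _    | yes _   | no _    = refl
    ... | yes _   | no _    | no _    | _       = refl
    ... | no _    | _       | yes p≡y | yes q≡x = ⊥-elim (¬j (inj₂ (p≡y , q≡x)))
    ... | no _    | _       | yes _   | no _    = refl
    ... | no _    | _       | no _    | _       = refl

record EdgeLabelling (G : Graph) (K : Set) : Set where
  open Graph G
  field
    _≟ᴸ_          : DecidableEquality K
    edge          : K → V × V
    label         : ∀ {x y} → Adj x y → K
    label-joins   : ∀ {x y} (a : Adj x y) → Joins (edge (label a)) x y
    joins⇒label   : ∀ {x y} (a : Adj x y) k → Joins (edge k) x y → k ≡ label a
    edge-adjacent : ∀ k → Adj (proj₁ (edge k)) (proj₂ (edge k))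
    adjacent-sym  : ∀ {x y} → Adj x y → Adj y x

module _ {G : Graph} {K : Set} (L : EdgeLabelling G K) where
  open Graph G
  open EdgeLabelling L

  occurrences : K → List K → ℕ
  occurrences k = length ∘ filter (_≟ᴸ k)

  countEdge-labelled : ∀ {x y} (a : Adj x y) {es ks} → Pointwise SameEdge es (map edge ks) →
                       countEdge _≟V_ x y es ≡ occurrences (label a) ks
  countEdge-labelled a {ks = []}    []          = refl
  countEdge-labelled a {ks = k ∷ _} (e≈ ∷ es≈) with k ≟ᴸ label a
  ... | yes refl = trans (countEdge-joins _≟V_ _ (Joins-resp (SameEdge-sym e≈) (label-joins a)))
                         (cong suc (countEdge-labelled a es≈))
  ... | no k≢ = trans (countEdge-¬joins _≟V_ _ (k≢ ∘ joins⇒label a k ∘ Joins-resp e≈))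
                      (countEdge-labelled a es≈)

  Unique⇒occurrences≡1 : ∀ {k ks} → Unique ks → k ∈ ks → occurrences k ks ≡ 1
  Unique⇒occurrences≡1 {k} (k∉ks ∷ _) (here refl) with k ≟ᴸ k
  ... | yes _   = cong (suc ∘ length) (filter-none (_≟ᴸ k) (All.map (_∘ sym) k∉ks))
  ... | no k≢k  = ⊥-elim (k≢k refl)
  Unique⇒occurrences≡1 {k} {x ∷ _} (x∉ks ∷ uniq) (there k∈ks) with x ≟ᴸ k
  ... | yes refl = ⊥-elim (All.lookup x∉ks k∈ks refl)
  ... | no _     = Unique⇒occurrences≡1 uniq k∈ks

  Adjacent : V × V → Set
  Adjacent (x , y) = Adj x y

  sameEdges⇒adjacent : ∀ {es ks} → Pointwise SameEdge es (map edge ks) → All Adjacent es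
  sameEdges⇒adjacent {ks = []}    []                 = []
  sameEdges⇒adjacent {ks = k ∷ _} (inj₁ refl ∷ es≈) = edge-adjacent k ∷ sameEdges⇒adjacent es≈
  sameEdges⇒adjacent {ks = k ∷ _} (inj₂ refl ∷ es≈) = adjacent-sym (edge-adjacent k) ∷ sameEdges⇒adjacent es≈

  isSunDecomposition : (S : List (Sun V)) (ks : List K) →
                       All (Unique ∘ sunVertices) S →
                       Pointwise SameEdge (concatMap sunEdges S) (map edge ks) →
                       Unique ks → (∀ k → k ∈ ks) →
                       IsSunDecomposition G S
  isSunDecomposition S ks distinct labelled unique complete = subgraph , once
    where
    subgraph : ∀ s → s ∈ S → Unique (sunVertices s) × All Adjacent (sunEdges s)
    subgraph s s∈S = All.lookup distinct s∈S
                   , All.lookup (All.map⁻ (All.concat⁻ (sameEdges⇒adjacent labelled))) s∈S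

    once : ∀ x y → Adj x y → countEdge _≟V_ x y (concatMap sunEdges S) ≡ 1
    once x y a = trans (countEdge-labelled a labelled) (Unique⇒occurrences≡1 unique (complete (label a)))

-- Arithmetic in ℤ_u

module Modular (u : ℕ) .{{_ : NonZero u}} (4<u : 4 < u) where

  [_] : ℕ → Fin u
  [ n ] = n mod u

  toℕ-[] : ∀ n → toℕ [ n ] ≡ n % u
  toℕ-[] n = toℕ-fromℕ< (m%n<n n u)

  []-toℕ : ∀ i → [ toℕ i ] ≡ i
  []-toℕ i = toℕ-injective (trans (toℕ-[] (toℕ i)) (m<n⇒m%n≡m (toℕ<n i)))

  [n+u]≡[n] : ∀ n → [ n + u ] ≡ [ n ]
  [n+u]≡[n] n = toℕ-injective (trans (toℕ-[] (n + u)) (trans ([m+n]%n≡m%n n u) (sym (toℕ-[] n))))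

  toℕ-[]-% : ∀ {d} .{{_ : NonZero d}} → d ∣ u → ∀ n → toℕ [ n ] % d ≡ n % d
  toℕ-[]-% {d} d∣u n = trans (cong (_% d) (toℕ-[] n)) (m∣n⇒o%n%m≡o%m d u n d∣u)

  next2 : Fin u → Fin u
  next2 i = [ toℕ i + 2 ]

  next2-[] : ∀ n → next2 [ n ] ≡ [ n + 2 ]
  next2-[] n = toℕ-injective (begin
    toℕ (next2 [ n ])       ≡⟨ toℕ-[] _ ⟩
    (toℕ [ n ] + 2) % u     ≡⟨ cong (λ m → (m + 2) % u) (toℕ-[] n) ⟩
    (n % u + 2) % u         ≡⟨ %-distribˡ-+ (n % u) 2 u ⟩
    (n % u % u + 2 % u) % u ≡⟨ cong (λ m → (m + 2 % u) % u) (m%n%n≡m%n n u) ⟩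
    (n % u + 2 % u) % u     ≡⟨ %-distribˡ-+ n 2 u ⟨
    (n + 2) % u             ≡⟨ toℕ-[] _ ⟨
    toℕ [ n + 2 ]           ∎)
    where open ≡-Reasoning

  arc : ℕ → ℕ
  arc d = d ⊓ (u ∸ d)

  arc-2 : arc 2 ≡ 2
  arc-2 = m≤n⇒m⊓n≡m (m+n≤o⇒m≤o∸n 2 (<⇒≤ 4<u))

  arc-complement : ∀ {d} → d ≤ u → arc (u ∸ d) ≡ arc d
  arc-complement {d} d≤u = trans (cong ((u ∸ d) ⊓_) (m∸[m∸n]≡n d≤u)) (⊓-comm (u ∸ d) d)

  circDist-sym : ∀ i j → circDist u i j ≡ circDist u j i
  circDist-sym i j = cong arc (∣-∣-comm (toℕ i) (toℕ j))

  circDist-next2 : ∀ i → circDist u i (next2 i) ≡ 2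
  circDist-next2 i with toℕ i + 2 <? u
  ... | yes a+2<u = begin
    arc ∣ a - toℕ (next2 i) ∣ ≡⟨ cong (λ b → arc ∣ a - b ∣) (trans (toℕ-[] _) (m<n⇒m%n≡m a+2<u)) ⟩
    arc ∣ a - a + 2 ∣         ≡⟨ cong arc (∣m-m+n∣≡n a 2) ⟩
    arc 2                     ≡⟨ arc-2 ⟩
    2                         ∎
    where open ≡-Reasoning ; a = toℕ i
  ... | no a+2≮u = begin
    arc ∣ a - b ∣             ≡⟨ cong arc (∣m+n-m+o∣≡∣n-o∣ 2 a b) ⟨
    arc ∣ 2 + a - 2 + b ∣     ≡⟨ cong (λ m → arc ∣ m - 2 + b ∣) (trans (+-comm 2 a) (sym wrap)) ⟩
    arc ∣ b + u - 2 + b ∣     ≡⟨ cong (λ m → arc ∣ b + u - m ∣) (+-comm 2 b) ⟩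
    arc ∣ b + u - b + 2 ∣     ≡⟨ cong arc (∣m+n-m+o∣≡∣n-o∣ b u 2) ⟩
    arc ∣ u - 2 ∣             ≡⟨ cong arc (m≤n⇒∣n-m∣≡n∸m 2≤u) ⟩
    arc (u ∸ 2)               ≡⟨ arc-complement 2≤u ⟩
    arc 2                     ≡⟨ arc-2 ⟩
    2                         ∎
    where
    open ≡-Reasoning
    a = toℕ i
    b = toℕ (next2 i)
    2≤u : 2 ≤ u
    2≤u = m+n≤o⇒n≤o 2 (<⇒≤ 4<u)
    wrap : b + u ≡ a + 2
    wrap = trans (cong (_+ u) (toℕ-[] _))
                 (%-wrap (≮⇒≥ a+2≮u) (+-mono-<-≤ (toℕ<n i) 2≤u))

  toℕ+2≡⇒next2≡ : ∀ {i j} → toℕ i + 2 ≡ toℕ j → next2 i ≡ j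
  toℕ+2≡⇒next2≡ {i} {j} e = trans (cong [_] e) ([]-toℕ j)

  next2≢id : ∀ i → ¬ i ≡ next2 i
  next2≢id i i≡next2i
    with () ← trans (sym (cong arc (∣n-n∣≡0 (toℕ i))))
                    (trans (cong (circDist u i) i≡next2i) (circDist-next2 i))

  toℕ-next2² : ∀ i → toℕ (next2 (next2 i)) ≡ (toℕ i + 4) % u
  toℕ-next2² i = begin
    toℕ (next2 (next2 i)) ≡⟨ cong toℕ (next2-[] (toℕ i + 2)) ⟩
    toℕ [ toℕ i + 2 + 2 ] ≡⟨ toℕ-[] _ ⟩
    (toℕ i + 2 + 2) % u   ≡⟨ cong (_% u) (+-assoc (toℕ i) 2 2) ⟩
    (toℕ i + 4) % u       ∎
    where open ≡-Reasoning

  next2²≢id : ∀ i → ¬ next2 (next2 i) ≡ i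
  next2²≢id i eq = [m+1+o]%n≢m 3 (toℕ<n i) 4<u (trans (sym (toℕ-next2² i)) (cong toℕ eq))

  circDist≡2⇒next2-≤ : ∀ i j → toℕ i ≤ toℕ j → circDist u i j ≡ 2 → j ≡ next2 i ⊎ i ≡ next2 j
  circDist≡2⇒next2-≤ i j a≤b dist≡2 = bySelection (⊓-sel d (u ∸ d))
    where
    open ≡-Reasoning
    a = toℕ i
    b = toℕ j
    d = b ∸ a

    arc≡2 : arc d ≡ 2
    arc≡2 = trans (cong arc (sym (m≤n⇒∣m-n∣≡n∸m a≤b))) dist≡2

    bySelection : arc d ≡ d ⊎ arc d ≡ u ∸ d → j ≡ next2 i ⊎ i ≡ next2 j
    bySelection (inj₁ arc≡d) = inj₁ (sym (toℕ+2≡⇒next2≡ (begin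
      a + 2 ≡⟨ cong (a +_) (trans (sym arc≡d) arc≡2) ⟨
      a + d ≡⟨ m+[n∸m]≡n a≤b ⟩
      b     ∎)))
    bySelection (inj₂ arc≡u∸d) = inj₂ (sym (begin
      next2 j     ≡⟨ cong [_] b+2≡a+u ⟩
      [ a + u ]   ≡⟨ [n+u]≡[n] a ⟩
      [ a ]       ≡⟨ []-toℕ i ⟩
      i           ∎))
      where
      d+2≡u : d + 2 ≡ u
      d+2≡u = trans (cong (d +_) (trans (sym arc≡2) arc≡u∸d))
                    (m+[n∸m]≡n (≤-trans (m∸n≤m b a) (<⇒≤ (toℕ<n j))))
      b+2≡a+u : b + 2 ≡ a + u
      b+2≡a+u = begin
        b + 2       ≡⟨ cong (_+ 2) (m+[n∸m]≡n a≤b) ⟨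
        a + d + 2   ≡⟨ +-assoc a d 2 ⟩
        a + (d + 2) ≡⟨ cong (a +_) d+2≡u ⟩
        a + u       ∎

  circDist≡2⇒next2 : ∀ i j → circDist u i j ≡ 2 → j ≡ next2 i ⊎ i ≡ next2 j
  circDist≡2⇒next2 i j dist≡2 with ≤-total (toℕ i) (toℕ j)
  ... | inj₁ a≤b = circDist≡2⇒next2-≤ i j a≤b dist≡2
  ... | inj₂ b≤a = Sum.swap (circDist≡2⇒next2-≤ j i b≤a (trans (circDist-sym j i) dist≡2))

data Kind : Set where
  spoke : Fin 4 → Kind
  chord : Kind

_≟ᴷ_ : DecidableEquality Kind
spoke h ≟ᴷ spoke h′ = Dec.map′ (cong spoke) (λ { refl → refl }) (h Fin.≟ h′)
spoke _ ≟ᴷ chord    = no λ ()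
chord   ≟ᴷ spoke _  = no λ ()
chord   ≟ᴷ chord    = yes refl

allKinds : List Kind
allKinds = chord ∷ map spoke (allFin 4)

∈-allKinds : ∀ κ → κ ∈ allKinds
∈-allKinds (spoke h) = there (∈-map⁺ spoke (∈-allFin h))
∈-allKinds chord     = here refl

-- pt n stands for the vertex 12 j + n of the j-th block (so pt 12 and pt 13 lie in the next one).
data Local : Set where
  pt : ℕ → Local
  ∞  : Fin 4 → Local

IsLocalEdge : Local × Local → Set
IsLocalEdge (pt n , ∞ _)  = n < 12
IsLocalEdge (∞ _  , pt n) = n < 12
IsLocalEdge (pt n , pt m) = n < 12 × m ≡ n + 2
IsLocalEdge (∞ _  , ∞ _)  = ⊥

isLocalEdge? : Decidable IsLocalEdge
isLocalEdge? (pt n , ∞ _)  = n <? 12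
isLocalEdge? (∞ _  , pt n) = n <? 12
isLocalEdge? (pt n , pt m) = n <? 12 ×-dec m ≟ n + 2
isLocalEdge? (∞ _  , ∞ _)  = no id

localLabel : Local × Local → Fin 12 × Kind
localLabel (pt n , ∞ h)  = n mod 12 , spoke h
localLabel (∞ h  , pt n) = n mod 12 , spoke h
localLabel (pt n , pt _) = n mod 12 , chord
localLabel (∞ _  , ∞ _)  = 0F , chord   -- junk: not a local edge

localLabels : Sun Local → List (Fin 12 × Kind)
localLabels = map localLabel ∘ sunEdges

residue : Local → ℕ ⊎ Fin 4
residue (pt n) = inj₁ (n % 12)
residue (∞ h)  = inj₂ h

baseBlock : List (Sun Local)
baseBlock =
  sun (∞ 0F) (pt 8) (pt 10) (pt 1)  (∞ 1F) (pt 12) ∷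
  sun (∞ 1F) (pt 0) (pt 2)  (pt 10) (∞ 2F) (∞ 0F)  ∷
  sun (∞ 2F) (pt 4) (pt 6)  (pt 10) (∞ 0F) (∞ 1F)  ∷
  sun (∞ 3F) (pt 2) (pt 4)  (pt 0)  (∞ 2F) (∞ 1F)  ∷
  sun (∞ 3F) (pt 6) (pt 8)  (pt 10) (∞ 0F) (∞ 2F)  ∷
  sun (∞ 0F) (pt 9) (pt 11) (pt 0)  (∞ 1F) (pt 13) ∷
  sun (∞ 1F) (pt 1) (pt 3)  (pt 11) (∞ 2F) (∞ 0F)  ∷
  sun (∞ 2F) (pt 5) (pt 7)  (pt 11) (∞ 0F) (∞ 1F)  ∷
  sun (∞ 3F) (pt 3) (pt 5)  (pt 1)  (∞ 2F) (∞ 1F)  ∷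
  sun (∞ 3F) (pt 7) (pt 9)  (pt 11) (∞ 0F) (∞ 2F)  ∷
  []

baseLabels : List (Fin 12 × Kind)
baseLabels = concatMap localLabels baseBlock

_≟ˡ_ : DecidableEquality (Fin 12 × Kind)
_≟ˡ_ = Productₚ.≡-dec Fin._≟_ _≟ᴷ_

baseBlock-localEdges : All (All IsLocalEdge ∘ sunEdges) baseBlock
baseBlock-localEdges = from-yes (All.all? (All.all? isLocalEdge? ∘ sunEdges) baseBlock)

baseBlock-residues : All (Unique ∘ map residue ∘ sunVertices) baseBlock
baseBlock-residues =
  from-yes (All.all? (DecUnique.unique? (Sumₚ.≡-dec _≟_ Fin._≟_) ∘ map residue ∘ sunVertices) baseBlock)

baseLabels-unique : Unique baseLabels
baseLabels-unique = from-yes (DecUnique.unique? _≟ˡ_ baseLabels)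

baseLabels-complete : ∀ ρ → ρ ∈ baseLabels
baseLabels-complete (r , κ) =
  All.lookup (from-yes (All.all? (λ ρ → DecMembership._∈?_ _≟ˡ_ ρ baseLabels) (cartesianProduct (allFin 12) allKinds)))
             (∈-cartesianProduct⁺ (∈-allFin r) (∈-allKinds κ))

-- Translates of the base block

module Construction (k : ℕ) where

  q u : ℕ
  q = suc k
  u = q * 12

  open Modular u (s≤s (s≤s (s≤s (s≤s (s≤s z≤n)))))

  G : Graph
  G = CircGraph u 4 (2 ∷ [])

  open Graph G using (V; Adj)

  Label : Set
  Label = Fin u × Kind

  edge : Label → V × V
  edge (i , spoke h) = inj₁ i , inj₂ h
  edge (i , chord)   = inj₁ i , inj₁ (next2 i)

  chordLabel : (i j : Fin u) → Dec (j ≡ next2 i) → Label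
  chordLabel i j (yes _) = i , chord
  chordLabel i j (no _)  = j , chord

  label : ∀ {x y} → Adj x y → Label
  label {inj₁ i} {inj₁ j} _ = chordLabel i j (j Fin.≟ next2 i)
  label {inj₁ i} {inj₂ h} _ = i , spoke h
  label {inj₂ h} {inj₁ i} _ = i , spoke h

  label-joins : ∀ {x y} (a : Adj x y) → Joins (edge (label a)) x y
  label-joins {inj₁ i} {inj₁ j} (_ , here dist≡2) with j Fin.≟ next2 i
  ... | yes j≡next2i = inj₁ (refl , cong inj₁ (sym j≡next2i))
  ... | no j≢next2i with circDist≡2⇒next2 i j dist≡2
  ...   | inj₁ j≡next2i = ⊥-elim (j≢next2i j≡next2i)
  ...   | inj₂ i≡next2j = inj₂ (refl , cong inj₁ (sym i≡next2j))
  label-joins {inj₁ i} {inj₂ h} _ = inj₁ (refl , refl)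
  label-joins {inj₂ h} {inj₁ i} _ = inj₂ (refl , refl)

  joins⇒label : ∀ {x y} (a : Adj x y) κ → Joins (edge κ) x y → κ ≡ label a
  joins⇒label _ (i , spoke h) (inj₁ (refl , refl)) = refl
  joins⇒label _ (i , spoke h) (inj₂ (refl , refl)) = refl
  joins⇒label _ (i , chord) (inj₁ (refl , refl)) with next2 i Fin.≟ next2 i
  ... | yes _   = refl
  ... | no ≢refl = ⊥-elim (≢refl refl)
  joins⇒label _ (i , chord) (inj₂ (refl , refl)) with i Fin.≟ next2 (next2 i)
  ... | yes i≡next2²i = ⊥-elim (next2²≢id i (sym i≡next2²i))
  ... | no _          = refl

  edge-adjacent : ∀ κ → Adj (proj₁ (edge κ)) (proj₂ (edge κ))
  edge-adjacent (i , spoke h) = tt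
  edge-adjacent (i , chord)   = next2≢id i , here (circDist-next2 i)

  adjacent-sym : ∀ {x y} → Adj x y → Adj y x
  adjacent-sym {inj₁ i} {inj₁ j} (i≢j , dist∈D) = i≢j ∘ sym , subst (_∈ 2 ∷ []) (circDist-sym i j) dist∈D
  adjacent-sym {inj₁ _} {inj₂ _} _ = tt
  adjacent-sym {inj₂ _} {inj₁ _} _ = tt

  labelling : EdgeLabelling G Label
  labelling = record
    { _≟ᴸ_          = Productₚ.≡-dec Fin._≟_ _≟ᴷ_
    ; edge          = edge
    ; label         = label
    ; label-joins   = label-joins
    ; joins⇒label   = joins⇒label
    ; edge-adjacent = edge-adjacent
    ; adjacent-sym  = adjacent-sym
    }

  place : Fin q → Local → V
  place j (pt n) = inj₁ [ 12 * toℕ j + n ]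
  place j (∞ h)  = inj₂ h

  placeEdge : Fin q → Local × Local → V × V
  placeEdge j (x , y) = place j x , place j y

  placeSun : Fin q → Sun Local → Sun V
  placeSun j (sun a b c d e f) = sun (place j a) (place j b) (place j c) (place j d) (place j e) (place j f)

  globalLabel : Fin q → Fin 12 × Kind → Label
  globalLabel j (r , κ) = combine j r , κ

  globalLabel-injective : ∀ {j j′ ρ ρ′} → globalLabel j ρ ≡ globalLabel j′ ρ′ → j ≡ j′ × ρ ≡ ρ′
  globalLabel-injective {j} {j′} {r , _} {r′ , _} eq
    with combine-injective j r j′ r′ (cong proj₁ eq) | cong proj₂ eq
  ... | refl , refl | refl = refl , refl

  combine-mod : ∀ (j : Fin q) {n} → n < 12 → combine j (n mod 12) ≡ [ 12 * toℕ j + n ]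
  combine-mod j {n} n<12 = begin
    combine j (n mod 12)                ≡⟨ []-toℕ (combine j (n mod 12)) ⟨
    [ toℕ (combine j (n mod 12)) ]      ≡⟨ cong [_] (toℕ-combine j (n mod 12)) ⟩
    [ 12 * toℕ j + toℕ (n mod 12) ]     ≡⟨ cong (λ r → [ 12 * toℕ j + r ]) (trans (toℕ-fromℕ< _) (m<n⇒m%n≡m n<12)) ⟩
    [ 12 * toℕ j + n ]                  ∎
    where open ≡-Reasoning

  placeEdge-labelled : ∀ j e → IsLocalEdge e → SameEdge (placeEdge j e) (edge (globalLabel j (localLabel e)))
  placeEdge-labelled j (pt n , ∞ h) n<12 = inj₁ (cong (λ i → inj₁ i , inj₂ h) (sym (combine-mod j n<12)))
  placeEdge-labelled j (∞ h , pt n) n<12 = inj₂ (cong (λ i → inj₂ h , inj₁ i) (sym (combine-mod j n<12)))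
  placeEdge-labelled j (pt n , pt .(n + 2)) (n<12 , refl) = inj₁ (sym (begin
    edge (combine j (n mod 12) , chord)  ≡⟨ cong (λ i → inj₁ i , inj₁ (next2 i)) (combine-mod j n<12) ⟩
    inj₁ [ m ] , inj₁ (next2 [ m ])      ≡⟨ cong (λ i → inj₁ [ m ] , inj₁ i) (next2-[] m) ⟩
    inj₁ [ m ] , inj₁ [ m + 2 ]          ≡⟨ cong (λ i → inj₁ [ m ] , inj₁ [ i ]) (+-assoc (12 * toℕ j) n 2) ⟩
    placeEdge j (pt n , pt (n + 2))      ∎))
    where
    open ≡-Reasoning
    m = 12 * toℕ j + n

  residueᵛ : V → ℕ ⊎ Fin 4
  residueᵛ (inj₁ i) = inj₁ (toℕ i % 12)
  residueᵛ (inj₂ h) = inj₂ h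

  residue-place : ∀ j x → residueᵛ (place j x) ≡ residue x
  residue-place j (pt n) = cong inj₁ (trans (toℕ-[]-% (divides q refl) (12 * toℕ j + n))
                                            (%-remove-+ˡ n (m∣m*n (toℕ j))))
  residue-place j (∞ h)  = refl

  placeSun-distinct : ∀ j s → Unique (map residue (sunVertices s)) → Unique (sunVertices (placeSun j s))
  placeSun-distinct j s distinct = Unique.map⁻ {f = residueᵛ} (subst Unique residues≡ distinct)
    where
    residues≡ : map residue (sunVertices s) ≡ map residueᵛ (map (place j) (sunVertices s))
    residues≡ = trans (map-cong (sym ∘ residue-place j) (sunVertices s))
                      (map-∘ {g = residueᵛ} {f = place j} (sunVertices s))

  placeSun-labelled : ∀ j s → All IsLocalEdge (sunEdges s) →
                      Pointwise SameEdge (sunEdges (placeSun j s)) (map edge (map (globalLabel j) (localLabels s)))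
  placeSun-labelled j s localEdges = All⇒Pointwise-map (All.map (placeEdge-labelled j _) localEdges)

  blocks : List (Fin q × Sun Local)
  blocks = cartesianProduct (allFin q) baseBlock

  blockSun : Fin q × Sun Local → Sun V
  blockSun (j , s) = placeSun j s

  blockLabels : Fin q × Sun Local → List Label
  blockLabels (j , s) = map (globalLabel j) (localLabels s)

  All-blocks : ∀ {P : Fin q × Sun Local → Set} → (∀ j {s} → s ∈ baseBlock → P (j , s)) → All P blocks
  All-blocks P = All.tabulate λ {(j , s)} b∈ → P j (proj₂ (∈-cartesianProduct⁻ (allFin q) baseBlock b∈))

  concatMap-blockLabels : concatMap blockLabels blocks ≡ cartesianProductWith globalLabel (allFin q) baseLabels
  concatMap-blockLabels = concatMap-cartesianProduct globalLabel localLabels (allFin q) baseBlock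

  blocks-distinct : All (Unique ∘ sunVertices) (map blockSun blocks)
  blocks-distinct =
    All.map⁺ (All-blocks λ j {s} s∈ → placeSun-distinct j s (All.lookup baseBlock-residues s∈))

  blocks-labelled : Pointwise SameEdge (concatMap sunEdges (map blockSun blocks))
                                       (map edge (concatMap blockLabels blocks))
  blocks-labelled =
    subst (λ es → Pointwise SameEdge es (map edge (concatMap blockLabels blocks)))
          (sym (concatMap-map sunEdges blockSun blocks))
          (Pointwise-concatMap (sunEdges ∘ blockSun) blockLabels edge {blocks}
            (All-blocks λ j {s} s∈ → placeSun-labelled j s (All.lookup baseBlock-localEdges s∈)))

  blockLabels-unique : Unique (concatMap blockLabels blocks)
  blockLabels-unique = subst Unique (sym concatMap-blockLabels)
    (Unique.cartesianProductWith⁺ globalLabel globalLabel-injective (Unique.allFin⁺ q) baseLabels-unique)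

  blockLabels-complete : ∀ l → l ∈ concatMap blockLabels blocks
  blockLabels-complete (i , κ) =
    subst (_∈ concatMap blockLabels blocks) (cong (_, κ) (combine-remQuot {q} 12 i))
          (subst (globalLabel j (r , κ) ∈_) (sym concatMap-blockLabels)
                 (∈-cartesianProductWith⁺ globalLabel (∈-allFin j) (baseLabels-complete (r , κ))))
    where
    j = proj₁ (remQuot {q} 12 i)
    r = proj₂ (remQuot {q} 12 i)

  decomposition : SunDecomposable G
  decomposition = map blockSun blocks
                , isSunDecomposition labelling (map blockSun blocks) (concatMap blockLabels blocks)
                    blocks-distinct blocks-labelled blockLabels-unique blockLabels-complete

lemma2p2 : (u : ℕ) → 0 < u → 12 ∣ u → SunDecomposable (CircGraph u 4 (2 ∷ []))
lemma2p2 .(0 * 12)     ()  (divides 0 refl)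
lemma2p2 .(suc k * 12) _   (divides (suc k) refl) = Construction.decomposition k
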